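{- For every integer $n \geq 1$, \[ B(n) = (-1)^{n+1} + 2 \sum_{k=0}^{\lfloor n/2\rfloor} (2k)!\, S(n,2k) = (-1)^n + 2 \sum_{k=0}^{\lfloor n/2\rfloor} (2k+1)!\, S(n,2k+1), \] and \[ B(n) = \sum_{k=1}^{\lfloor (n+1)/2\rfloor} (2k-1)!\, S(n+1,2k) = \sum_{k=0}^{\lfloor (n+1)/2\rfloor} (2k)!\, S(n+1,2k+1). \]
   Context: For integers $n,k \geq 0$, $S(n,k)$ denotes the Stirling number of the second kind, i.e., the number of partitions of an $n$-element set into $k$ nonempty blocks (with $S(0,0)=1$, $S(n,0)=0$ for $n\geq 1$, and $S(n,k)=0$ for $k>n$). $B(n)$ denotes the $n$-th ordered Bell (Fubini) number, $B(n)=\sum_{k=0}^{n} k!\, S(n,k)$, equivalently given by the exponential generating function $\sum_{n\ge 0} B(n) x^n/n! = 1/(2-e^x)$. -}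

module Defs where

open import Data.Nat using (ℕ; zero; suc; _+_; _*_)
open import Data.Nat using (_!)
open import Data.Integer as ℤ using (ℤ)

S : ℕ → ℕ → ℕ
S zero    zero    = 1
S zero    (suc k) = 0
S (suc n) zero    = 0
S (suc n) (suc k) = suc k * S n (suc k) + S n k

sumTo : ℕ → (ℕ → ℕ) → ℕ
sumTo zero    f = f zero
sumTo (suc n) f = sumTo n f + f (suc n)

sum1To : ℕ → (ℕ → ℕ) → ℕ
sum1To zero    f = 0
sum1To (suc m) f = sum1To m f + f (suc m)

B : ℕ → ℕ
B n = sumTo n (λ k → (k !) * S n k)

negOnePow : ℕ → ℤ
negOnePow zero    = ℤ.+ 1
negOnePow (suc n) = ℤ.- negOnePow n

{-# OPTIONS --safe #-}
module Submission where

-- Write surj n k = k! S(n,k), so that B n = E n + O n with E n, O n the sums of surj n k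
-- over even and odd k.  The recurrence gives
--   surj (n+1) k + surj n k = (k+1) surj n k + k surj n (k-1),
-- and summing the right-hand side over even k or over odd k gives the same value
-- Σ_j (j+1) surj n j.  Hence E − O changes sign with n, so E n − O n = (−1)^n, and the
-- first two identities are B = 2E − (E − O) = (E − O) + 2O.  For the last two,
-- k! S(n+1,k+1) = surj n k + surj n (k+1), so summing over even, resp. odd, k regroups
-- B n into consecutive pairs (the unpaired term surj n 0 vanishes for n ≥ 1).

open import Defs
open import Data.Nat using (ℕ; zero; suc; _+_; _*_; _∸_; _/_; _%_; _≤_; _<_; _≥_; z≤n; s≤s; _!)
open import Data.Nat.Properties
open import Data.Nat.DivMod using (m≡m%n+[m/n]*n; m%n<n)
open import Data.Nat.Solver using (module +-*-Solver)
import Data.Integer as ℤ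
import Data.Integer.Properties as ℤP
import Data.Integer.Solver as ℤSolver
open import Data.Product using (_×_; _,_)
open import Data.Sum using (inj₁; inj₂)
open import Relation.Binary.PropositionalEquality
  using (_≡_; refl; sym; trans; cong; cong₂; subst; module ≡-Reasoning)

open +-*-Solver
module ℤS = ℤSolver.+-*-Solver

sumTo-cong : ∀ M {f g : ℕ → ℕ} → (∀ k → f k ≡ g k) → sumTo M f ≡ sumTo M g
sumTo-cong zero    f≗g = f≗g 0
sumTo-cong (suc M) f≗g = cong₂ _+_ (sumTo-cong M f≗g) (f≗g (suc M))

sumTo-distrib-+ : ∀ M (f g : ℕ → ℕ) → sumTo M (λ k → f k + g k) ≡ sumTo M f + sumTo M g
sumTo-distrib-+ zero    f g = refl
sumTo-distrib-+ (suc M) f g rewrite sumTo-distrib-+ M f g =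
  solve 4 (λ x y z w → (x :+ y) :+ (z :+ w) := (x :+ z) :+ (y :+ w)) refl
    (sumTo M f) (sumTo M g) (f (suc M)) (g (suc M))

sumTo-stable : ∀ {b m} (f : ℕ → ℕ) → (∀ k → b < k → f k ≡ 0) → b ≤ m → sumTo m f ≡ sumTo b f
sumTo-stable {m = zero}  f _ z≤n = refl
sumTo-stable {m = suc m} f f≡0 b≤1+m with m≤n⇒m<n∨m≡n b≤1+m
... | inj₂ refl = refl
... | inj₁ (s≤s b≤m) rewrite sumTo-stable f f≡0 b≤m | f≡0 (suc m) (s≤s b≤m) = +-identityʳ _

sum1To≡sumTo : ∀ M (f : ℕ → ℕ) → f 0 ≡ 0 → sum1To M f ≡ sumTo M f
sum1To≡sumTo zero    f f0≡0 = sym f0≡0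
sum1To≡sumTo (suc M) f f0≡0 = cong (_+ f (suc M)) (sum1To≡sumTo M f f0≡0)

sumTo-split-parity : ∀ M (h : ℕ → ℕ) →
  sumTo (suc (2 * M)) h ≡ sumTo M (λ k → h (2 * k)) + sumTo M (λ k → h (2 * k + 1))
sumTo-split-parity zero    h = refl
sumTo-split-parity (suc M) h = begin
    sumTo (suc (2 * suc M)) h
  ≡⟨ cong (λ t → sumTo (suc t) h) (*-suc 2 M) ⟩
    sumTo (suc (2 * M)) h + h (2 + 2 * M) + h (3 + 2 * M)
  ≡⟨ cong (λ s → s + h (2 + 2 * M) + h (3 + 2 * M)) (sumTo-split-parity M h) ⟩
    Σeven + Σodd + h (2 + 2 * M) + h (3 + 2 * M)
  ≡⟨ solve 4 (λ e o x y → e :+ o :+ x :+ y := (e :+ x) :+ (o :+ y)) refl Σeven Σodd _ _ ⟩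
    (Σeven + h (2 + 2 * M)) + (Σodd + h (3 + 2 * M))
  ≡⟨ cong₂ (λ s t → (Σeven + h s) + (Σodd + h t))
       (sym (*-suc 2 M)) (trans (cong suc (sym (*-suc 2 M))) (+-comm 1 (2 * suc M))) ⟩
    (Σeven + h (2 * suc M)) + (Σodd + h (2 * suc M + 1))
  ∎
  where
  open ≡-Reasoning
  Σeven = sumTo M (λ k → h (2 * k))
  Σodd  = sumTo M (λ k → h (2 * k + 1))

sumTo-shift : ∀ (e u v : ℕ → ℕ) → e 0 ≡ u 0 → (∀ j → e (suc j) ≡ u (suc j) + v j) →
              ∀ M → sumTo M e + v M ≡ sumTo M (λ j → u j + v j)
sumTo-shift e u v e0 e-suc zero    = cong (_+ v 0) e0
sumTo-shift e u v e0 e-suc (suc M) = begin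
    sumTo M e + e (suc M) + v (suc M)
  ≡⟨ cong (λ t → sumTo M e + t + v (suc M)) (e-suc M) ⟩
    sumTo M e + (u (suc M) + v M) + v (suc M)
  ≡⟨ solve 4 (λ s x y z → s :+ (x :+ y) :+ z := (s :+ y) :+ (x :+ z)) refl
       (sumTo M e) (u (suc M)) (v M) (v (suc M)) ⟩
    (sumTo M e + v M) + (u (suc M) + v (suc M))
  ≡⟨ cong (_+ (u (suc M) + v (suc M))) (sumTo-shift e u v e0 e-suc M) ⟩
    sumTo M (λ j → u j + v j) + (u (suc M) + v (suc M))
  ∎
  where open ≡-Reasoning

n≤1+2*[n/2] : ∀ n → n ≤ suc (2 * (n / 2))
n≤1+2*[n/2] n = begin
    n
  ≡⟨ m≡m%n+[m/n]*n n 2 ⟩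
    n % 2 + n / 2 * 2
  ≤⟨ +-monoˡ-≤ (n / 2 * 2) (≤-pred (m%n<n n 2)) ⟩
    suc (n / 2 * 2)
  ≡⟨ cong suc (*-comm (n / 2) 2) ⟩
    suc (2 * (n / 2))
  ∎
  where open ≤-Reasoning

S-vanish : ∀ {n k} → n < k → S n k ≡ 0
S-vanish {zero}  {suc k} _          = refl
S-vanish {suc n} {suc k} (s≤s n<k) = begin
    suc k * S n (suc k) + S n k
  ≡⟨ cong₂ (λ x y → suc k * x + y) (S-vanish (m<n⇒m<1+n n<k)) (S-vanish n<k) ⟩
    suc k * 0 + 0
  ≡⟨ cong (_+ 0) (*-zeroʳ (suc k)) ⟩
    0
  ∎
  where open ≡-Reasoning

surj : ℕ → ℕ → ℕ
surj n k = k ! * S n k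

surj-vanish : ∀ {n k} → n < k → surj n k ≡ 0
surj-vanish {k = k} n<k = trans (cong (k ! *_) (S-vanish n<k)) (*-zeroʳ (k !))

surj-zero : ∀ {n} → n ≥ 1 → surj n 0 ≡ 0
surj-zero (s≤s _) = refl

!*S-suc-suc : ∀ n k → k ! * S (suc n) (suc k) ≡ surj n (suc k) + surj n k
!*S-suc-suc n k =
  solve 4 (λ k f s₁ s₀ → f :* ((con 1 :+ k) :* s₁ :+ s₀) := ((con 1 :+ k) :* f) :* s₁ :+ f :* s₀)
    refl k (k !) (S n (suc k)) (S n k)

surj-suc-+ : ∀ n k → surj (suc n) (suc k) + surj n (suc k) ≡ (2 + k) * surj n (suc k) + suc k * surj n k
surj-suc-+ n k = begin
    suc k * k ! * S (suc n) (suc k) + surj n (suc k)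
  ≡⟨ cong (_+ surj n (suc k)) (*-assoc (suc k) (k !) _) ⟩
    suc k * (k ! * S (suc n) (suc k)) + surj n (suc k)
  ≡⟨ cong (λ t → suc k * t + surj n (suc k)) (!*S-suc-suc n k) ⟩
    suc k * (surj n (suc k) + surj n k) + surj n (suc k)
  ≡⟨ solve 3 (λ k x y → (con 1 :+ k) :* (x :+ y) :+ x := (con 2 :+ k) :* x :+ (con 1 :+ k) :* y)
       refl k (surj n (suc k)) (surj n k) ⟩
    (2 + k) * surj n (suc k) + suc k * surj n k
  ∎
  where open ≡-Reasoning

evenSum oddSum : ℕ → ℕ → ℕ
evenSum n M = sumTo M (λ k → surj n (2 * k))
oddSum  n M = sumTo M (λ k → surj n (2 * k + 1))

B≡evenSum+oddSum : ∀ {n} M → n ≤ suc (2 * M) → B n ≡ evenSum n M + oddSum n M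
B≡evenSum+oddSum {n} M n≤1+2M =
  trans (sym (sumTo-stable (surj n) (λ _ → surj-vanish) n≤1+2M)) (sumTo-split-parity M (surj n))

evenSum+evenSum≡oddSum+oddSum : ∀ {n} M → n ≤ 2 * M →
  evenSum (suc n) M + evenSum n M ≡ oddSum (suc n) M + oddSum n M
evenSum+evenSum≡oddSum+oddSum {n} M n≤2M = begin
    evenSum (suc n) M + evenSum n M
  ≡⟨ sym (sumTo-distrib-+ M _ _) ⟩
    sumTo M evenTerm
  ≡⟨ sym (trans (cong (sumTo M evenTerm +_) v-last) (+-identityʳ _)) ⟩
    sumTo M evenTerm + v M
  ≡⟨ sumTo-shift evenTerm u v (sym (+-identityʳ _)) evenTerm-suc M ⟩
    sumTo M (λ j → u j + v j)
  ≡⟨ sumTo-cong M u+v≡oddTerm ⟩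
    sumTo M (λ k → surj (suc n) (2 * k + 1) + surj n (2 * k + 1))
  ≡⟨ sumTo-distrib-+ M _ _ ⟩
    oddSum (suc n) M + oddSum n M
  ∎
  where
  open ≡-Reasoning
  -- evenTerm (suc j) = u (suc j) + v j while the odd term at j is u j + v j,
  -- so the two sums differ only by v M, which vanishes.
  evenTerm u v : ℕ → ℕ
  evenTerm k = surj (suc n) (2 * k) + surj n (2 * k)
  u j = suc (2 * j) * surj n (2 * j)
  v j = (2 + 2 * j) * surj n (suc (2 * j))

  evenTerm-suc : ∀ j → evenTerm (suc j) ≡ u (suc j) + v j
  evenTerm-suc j = subst (λ t → surj (suc n) t + surj n t ≡ suc t * surj n t + v j)
                     (sym (*-suc 2 j)) (surj-suc-+ n (suc (2 * j)))

  u+v≡oddTerm : ∀ k → u k + v k ≡ surj (suc n) (2 * k + 1) + surj n (2 * k + 1)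
  u+v≡oddTerm k = subst (λ t → u k + v k ≡ surj (suc n) t + surj n t) (sym (+-comm (2 * k) 1))
                    (trans (+-comm (u k) (v k)) (sym (surj-suc-+ n (2 * k))))

  v-last : v M ≡ 0
  v-last = trans (cong ((2 + 2 * M) *_) (surj-vanish (s≤s n≤2M))) (*-zeroʳ (2 + 2 * M))

p+q≡r+s⇒p-r≡-[q-s] : ∀ p q r s → p + q ≡ r + s → ℤ.+ p ℤ.- ℤ.+ r ≡ ℤ.- (ℤ.+ q ℤ.- ℤ.+ s)
p+q≡r+s⇒p-r≡-[q-s] p q r s p+q≡r+s = begin
    ℤ.+ p ℤ.- ℤ.+ r
  ≡⟨ ℤS.solve 3 (λ x y z → x ℤS.:- z ℤS.:= (x ℤS.:+ y) ℤS.:- (y ℤS.:+ z)) refl (ℤ.+ p) (ℤ.+ q) (ℤ.+ r) ⟩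
    ℤ.+ (p + q) ℤ.- (ℤ.+ q ℤ.+ ℤ.+ r)
  ≡⟨ cong (λ t → ℤ.+ t ℤ.- (ℤ.+ q ℤ.+ ℤ.+ r)) p+q≡r+s ⟩
    ℤ.+ (r + s) ℤ.- (ℤ.+ q ℤ.+ ℤ.+ r)
  ≡⟨ ℤS.solve 3 (λ x y z → (z ℤS.:+ y) ℤS.:- (x ℤS.:+ z) ℤS.:= ℤS.:- (x ℤS.:- y)) refl (ℤ.+ q) (ℤ.+ s) (ℤ.+ r) ⟩
    ℤ.- (ℤ.+ q ℤ.- ℤ.+ s)
  ∎
  where open ≡-Reasoning

evenSum-oddSum≡negOnePow : ∀ {n} M → n ≤ suc (2 * M) → ℤ.+ evenSum n M ℤ.- ℤ.+ oddSum n M ≡ negOnePow n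
evenSum-oddSum≡negOnePow {zero} M _ = cong₂ (λ x y → ℤ.+ x ℤ.- ℤ.+ y)
  (sumTo-stable {m = M} (λ k → surj 0 (2 * k)) (λ { (suc k) _ → *-zeroʳ ((2 * suc k) !) }) z≤n)
  (sumTo-stable {m = M} (λ k → surj 0 (2 * k + 1)) (λ k _ → surj-vanish (m≤n+m 1 (2 * k))) z≤n)
evenSum-oddSum≡negOnePow {suc n} M (s≤s n≤2M) =
  trans (p+q≡r+s⇒p-r≡-[q-s] (evenSum (suc n) M) (evenSum n M) (oddSum (suc n) M) (oddSum n M)
          (evenSum+evenSum≡oddSum+oddSum M n≤2M))
        (cong ℤ.-_ (evenSum-oddSum≡negOnePow M (m≤n⇒m≤1+n n≤2M)))

e+o≡-[e-o]+2e : ∀ e o → ℤ.+ (e + o) ≡ ℤ.- (ℤ.+ e ℤ.- ℤ.+ o) ℤ.+ ℤ.+ (2 * e)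
e+o≡-[e-o]+2e e o rewrite ℤP.pos-+ e o | ℤP.pos-* 2 e =
  ℤS.solve 2 (λ x y → x ℤS.:+ y ℤS.:= ℤS.:- (x ℤS.:- y) ℤS.:+ ℤS.con (ℤ.+ 2) ℤS.:* x) refl (ℤ.+ e) (ℤ.+ o)

e+o≡[e-o]+2o : ∀ e o → ℤ.+ (e + o) ≡ (ℤ.+ e ℤ.- ℤ.+ o) ℤ.+ ℤ.+ (2 * o)
e+o≡[e-o]+2o e o rewrite ℤP.pos-+ e o | ℤP.pos-* 2 o =
  ℤS.solve 2 (λ x y → x ℤS.:+ y ℤS.:= (x ℤS.:- y) ℤS.:+ ℤS.con (ℤ.+ 2) ℤS.:* y) refl (ℤ.+ e) (ℤ.+ o)

B≡sum-!*S-suc-odd : ∀ n → B n ≡ sumTo (suc n / 2) (λ k → (2 * k) ! * S (suc n) (2 * k + 1))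
B≡sum-!*S-suc-odd n = begin
    B n
  ≡⟨ B≡evenSum+oddSum M (m≤n⇒m≤1+n (≤-pred (n≤1+2*[n/2] (suc n)))) ⟩
    evenSum n M + oddSum n M
  ≡⟨ sym (sumTo-distrib-+ M _ _) ⟩
    sumTo M (λ k → surj n (2 * k) + surj n (2 * k + 1))
  ≡⟨ sumTo-cong M pair≡ ⟩
    sumTo M (λ k → (2 * k) ! * S (suc n) (2 * k + 1))
  ∎
  where
  open ≡-Reasoning
  M = suc n / 2
  pair≡ : ∀ k → surj n (2 * k) + surj n (2 * k + 1) ≡ (2 * k) ! * S (suc n) (2 * k + 1)
  pair≡ k = subst (λ t → surj n (2 * k) + surj n t ≡ (2 * k) ! * S (suc n) t) (sym (+-comm (2 * k) 1))
              (trans (+-comm (surj n (2 * k)) (surj n (suc (2 * k)))) (sym (!*S-suc-suc n (2 * k))))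

B≡sum1-!*S-suc-even : ∀ {n} → n ≥ 1 → B n ≡ sum1To (suc n / 2) (λ k → (2 * k ∸ 1) ! * S (suc n) (2 * k))
B≡sum1-!*S-suc-even {n} n≥1 = begin
    B n
  ≡⟨ B≡evenSum+oddSum M (m≤n⇒m≤1+n n≤2M) ⟩
    evenSum n M + oddSum n M
  ≡⟨ sym (sumTo-distrib-+ M _ _) ⟩
    sumTo M (λ j → surj n (2 * j) + surj n (2 * j + 1))
  ≡⟨ sym (sumTo-shift g (λ j → surj n (2 * j)) (λ j → surj n (2 * j + 1)) (sym (surj-zero n≥1)) g-suc M) ⟩
    sumTo M g + surj n (2 * M + 1)
  ≡⟨ trans (cong (sumTo M g +_) (surj-vanish n<2M+1)) (+-identityʳ _) ⟩
    sumTo M g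
  ≡⟨ sym (sum1To≡sumTo M g refl) ⟩
    sum1To M g
  ∎
  where
  open ≡-Reasoning
  M = suc n / 2
  g : ℕ → ℕ
  g k = (2 * k ∸ 1) ! * S (suc n) (2 * k)

  n≤2M : n ≤ 2 * M
  n≤2M = ≤-pred (n≤1+2*[n/2] (suc n))

  n<2M+1 : n < 2 * M + 1
  n<2M+1 = subst (n <_) (+-comm 1 (2 * M)) (s≤s n≤2M)

  g-suc : ∀ j → g (suc j) ≡ surj n (2 * suc j) + surj n (2 * j + 1)
  g-suc j = subst (λ t → (t ∸ 1) ! * S (suc n) t ≡ surj n t + surj n (2 * j + 1)) (sym (*-suc 2 j))
              (subst (λ t → suc (2 * j) ! * S (suc n) (suc (suc (2 * j))) ≡ surj n (2 + 2 * j) + surj n t)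
                 (sym (+-comm (2 * j) 1)) (!*S-suc-suc n (suc (2 * j))))

theorem1 : (n : ℕ) → n ≥ 1 →
    ((ℤ.+ B n) ≡ negOnePow (n + 1) ℤ.+ ℤ.+ (2 * sumTo (n / 2) (λ k → ((2 * k) !) * S n (2 * k))))
    × ((ℤ.+ B n) ≡ negOnePow n ℤ.+ ℤ.+ (2 * sumTo (n / 2) (λ k → ((2 * k + 1) !) * S n (2 * k + 1))))
    × (B n ≡ sum1To ((n + 1) / 2) (λ k → ((2 * k ∸ 1) !) * S (n + 1) (2 * k)))
    × (B n ≡ sumTo ((n + 1) / 2) (λ k → ((2 * k) !) * S (n + 1) (2 * k + 1)))
theorem1 n n≥1 rewrite +-comm n 1 =
    trans B≡ (subst (λ s → ℤ.+ (E + O) ≡ ℤ.- s ℤ.+ ℤ.+ (2 * E)) alternating (e+o≡-[e-o]+2e E O))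
  , trans B≡ (subst (λ s → ℤ.+ (E + O) ≡ s ℤ.+ ℤ.+ (2 * O)) alternating (e+o≡[e-o]+2o E O))
  , B≡sum1-!*S-suc-even n≥1
  , B≡sum-!*S-suc-odd n
  where
  E = evenSum n (n / 2)
  O = oddSum n (n / 2)
  B≡ : ℤ.+ B n ≡ ℤ.+ (E + O)
  B≡ = cong ℤ.+_ (B≡evenSum+oddSum (n / 2) (n≤1+2*[n/2] n))
  alternating : ℤ.+ E ℤ.- ℤ.+ O ≡ negOnePow n
  alternating = evenSum-oddSum≡negOnePow (n / 2) (n≤1+2*[n/2] n)
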